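{- Let $D=(V,A)$ be a digraph, $k\in\mathbb{N}$, and $\mathcal{B}=(\mathcal{B}_0,\dots,\mathcal{B}_{k-1})$ with $\mathcal{B}_i=(V_i,A_i)$ pairwise edge-disjoint branchings in $D$, such that for every $\varnothing\neq X\subseteq V$, $\varrho_{D\setminus\mathcal{B}}(X)\geq|\{i<k:V_i\cap X=\varnothing\}|$. If $X,Y\subseteq V$ are dangerous and $X\cap Y\neq\varnothing$, then $X\cap Y$ is also dangerous.
   Context: $D\setminus\mathcal{B}=(V,A\setminus\bigcup_{i<k}A_i)$; $\varrho_H(X)$ is the cardinality of the set of edges of $H$ entering $X$. A branching is a digraph whose weakly connected components are arborescences; $V_i$ is the vertex set of $\mathcal{B}_i$. A set $\varnothing\neq X\subseteq V$ is tight (with respect to $\mathcal{B}$) if $\varrho_{D\setminus\mathcal{B}}(X)=|\{i<k:V_i\cap X=\varnothing\}|$, and dangerous if it is tight and $X\cap V_0\neq\varnothing$. -}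

module Defs where

open import Data.Nat using (ℕ)
open import Data.Bool using (Bool; true; false; _∧_; not)
import Data.Bool.Properties as BoolP
open import Data.Fin using (Fin; toℕ)
open import Data.Fin.Subset using (Subset; _∈_; _∉_; _∩_; ∁; ⋃; ⊥; ∣_∣; Nonempty)
open import Data.Vec using (tabulate; lookup)
open import Data.Vec.Properties using (≡-dec)
import Data.List as List
open import Data.Product using (Σ; _×_; ∃)
open import Data.Sum using (_⊎_)
open import Relation.Nullary using (¬_)
open import Relation.Nullary.Decidable using (⌊_⌋)
open import Relation.Binary.PropositionalEquality using (_≡_)

-- A finite digraph (multiple arcs and loops allowed) with vertex set Fin n
-- and arc set Fin m; arc a goes from  tail a  to  head a.
record Digraph : Set where
  field
    n    : ℕ
    m    : ℕ
    tail : Fin m → Fin n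
    head : Fin m → Fin n

module _ (D : Digraph) where
  open Digraph D

  Vertices : Set
  Vertices = Subset n

  Arcs : Set
  Arcs = Subset m

  ϱ : Arcs → Vertices → ℕ
  ϱ H X = ∣ tabulate (λ a → lookup H a ∧ (lookup X (head a) ∧ not (lookup X (tail a)))) ∣

  IsSubgraph : Vertices → Arcs → Set
  IsSubgraph S F = ∀ a → a ∈ F → (tail a ∈ S) × (head a ∈ S)

  data WConn (F : Arcs) : Fin n → Fin n → Set where
    here : ∀ {u} → WConn F u u
    fwd  : ∀ {u} a → a ∈ F → WConn F u (tail a) → WConn F u (head a)
    bwd  : ∀ {u} a → a ∈ F → WConn F u (head a) → WConn F u (tail a)

  data Reach (F : Arcs) : Fin n → Fin n → Set where
    here : ∀ {u} → Reach F u u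
    step : ∀ {u} a → a ∈ F → Reach F u (tail a) → Reach F u (head a)

  UniqueIn : Arcs → Fin n → Set
  UniqueIn F v = Σ (Fin m) λ a → (a ∈ F) × (head a ≡ v) ×
                   (∀ b → b ∈ F → head b ≡ v → b ≡ a)

  IsArborescenceOn : Arcs → (Fin n → Set) → Fin n → Set
  IsArborescenceOn F C r =
    C r ×
    (∀ a → a ∈ F → head a ≡ r → ⊥′) ×
    (∀ v → C v → ¬ (v ≡ r) → UniqueIn F v) ×
    (∀ v → C v → Reach F r v)
    where
      open import Data.Empty renaming (⊥ to ⊥′)

  -- (S , F) is a branching in D: a subgraph of D each of whose weakly
  -- connected components is an arborescence.
  IsBranching : Vertices → Arcs → Set
  IsBranching S F =
    IsSubgraph S F ×
    (∀ u → u ∈ S → ∃ λ r → IsArborescenceOn F (WConn F u) r)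

  module _ {k : ℕ} (V : Fin k → Vertices) (A : Fin k → Arcs) where

    remaining : Arcs
    remaining = ∁ (⋃ (List.tabulate A))

    missing : Vertices → ℕ
    missing X = ∣ tabulate (λ i → ⌊ ≡-dec BoolP._≟_ (V i ∩ X) ⊥ ⌋) ∣

    Tight : Vertices → Set
    Tight X = Nonempty X × (ϱ remaining X ≡ missing X)

    -- X is dangerous: tight and X ∩ V_0 ≠ ∅ (requires k ≥ 1)
    Dangerous : Vertices → Set
    Dangerous X = Tight X × (Σ (Fin k) λ i → (toℕ i ≡ 0) × Nonempty (X ∩ V i))

module Submission where

-- This is an uncrossing argument.  The in-degree  ϱ_H  of the arc set
-- H = D ∖ 𝓑  is submodular on vertex sets, while the deficiency
-- μ(Z) = |{i : V_i ∩ Z = ∅}|  is supermodular.  Hence for tight X, Y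
--   ϱ(X∩Y) + ϱ(X∪Y) ≤ ϱ(X) + ϱ(Y) = μ(X) + μ(Y) ≤ μ(X∩Y) + μ(X∪Y),
-- and since the cut condition gives  ϱ ≥ μ  on the nonempty sets X∩Y
-- and X∪Y, all these inequalities are equalities: X∩Y is tight.
-- If moreover X∩Y missed V_0 although X and Y both meet it, the index 0
-- would make the supermodular inequality strict, a contradiction.

open import Defs
open import Data.Nat using (ℕ; _≥_)
open import Data.Fin using (Fin)
open import Data.Fin.Subset using (Subset; _∩_; ⊥; Nonempty)
open import Relation.Nullary using (¬_)
open import Relation.Binary.PropositionalEquality using (_≡_)

open import Data.Bool using (Bool; true; false; _∧_; _∨_; not; T)
import Data.Bool.Properties as BoolP
open import Data.Unit using (tt)
open import Data.Nat using (zero; suc; _+_; _≤_; _<_; _≤ᵇ_; z≤n; s≤s)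
open import Data.Nat.Properties
  using (≤ᵇ⇒≤; ≤-trans; ≤-antisym; ≤-reflexive; +-mono-≤; +-mono-≤-<;
         +-monoʳ-≤; +-cancelʳ-≤; <⇒≱; +-0-commutativeMonoid)
open import Data.Fin using () renaming (zero to fzero; suc to fsuc)
open import Data.Fin.Properties using (toℕ-injective)
open import Data.Fin.Subset using (_∪_; _∈_; _∉_; ∣_∣)
open import Data.Fin.Subset.Properties
  using (Empty-unique; x∈p∩q⁺; x∈p∩q⁻; x∈p∪q⁻; p⊆p∪q; ∉⊥; nonempty?)
open import Data.Vec using (tabulate; lookup)
open import Data.Vec.Properties using (≡-dec; lookup-zipWith)
open import Data.Product using (_,_; proj₁; proj₂)
open import Data.Sum using ([_,_])
open import Data.Empty using (⊥-elim)
open import Relation.Nullary using (yes; no)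
open import Relation.Nullary.Decidable using (⌊_⌋)
open import Relation.Binary.PropositionalEquality
  using (refl; sym; trans; cong₂; subst; subst₂; module ≡-Reasoning)
open import Function using (_∘_)
open import Algebra.Properties.CommutativeMonoid.Sum +-0-commutativeMonoid
  using (sum; ∑-distrib-+)

bit : Bool → ℕ
bit true  = 1
bit false = 0

∣tabulate∣≡sum : ∀ {N} (f : Fin N → Bool) → ∣ tabulate f ∣ ≡ sum (bit ∘ f)
∣tabulate∣≡sum {zero}  f = refl
∣tabulate∣≡sum {suc N} f with f fzero
... | true  = cong₂ _+_ refl (∣tabulate∣≡sum (f ∘ fsuc))
... | false = ∣tabulate∣≡sum (f ∘ fsuc)

sum-mono-≤ : ∀ {N} {f g : Fin N → ℕ} → (∀ i → f i ≤ g i) → sum f ≤ sum g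
sum-mono-≤ {zero}  f≤g = z≤n
sum-mono-≤ {suc N} f≤g = +-mono-≤ (f≤g fzero) (sum-mono-≤ (f≤g ∘ fsuc))

sum-mono-< : ∀ {N} {f g : Fin N → ℕ} →
  (∀ i → f i ≤ g i) → (j : Fin N) → f j < g j → sum f < sum g
sum-mono-< f≤g fzero    fj<gj = +-mono-≤-<′ fj<gj (sum-mono-≤ (f≤g ∘ fsuc))
  where
  +-mono-≤-<′ : ∀ {a b c d} → a < b → c ≤ d → a + c < b + d
  +-mono-≤-<′ (s≤s a≤b) c≤d = s≤s (+-mono-≤ a≤b c≤d)
sum-mono-< f≤g (fsuc j) fj<gj =
  +-mono-≤-< (f≤g fzero) (sum-mono-< (f≤g ∘ fsuc) j fj<gj)

count-pair≡sum : ∀ {N} (u v : Fin N → Bool) →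
  ∣ tabulate u ∣ + ∣ tabulate v ∣ ≡ sum (λ i → bit (u i) + bit (v i))
count-pair≡sum u v = begin
  ∣ tabulate u ∣ + ∣ tabulate v ∣    ≡⟨ cong₂ _+_ (∣tabulate∣≡sum u) (∣tabulate∣≡sum v) ⟩
  sum (bit ∘ u) + sum (bit ∘ v)      ≡⟨ sym (∑-distrib-+ (bit ∘ u) (bit ∘ v)) ⟩
  sum (λ i → bit (u i) + bit (v i))  ∎
  where open ≡-Reasoning

count-pair-≤ : ∀ {N} (f g h k : Fin N → Bool) →
  (∀ i → bit (f i) + bit (g i) ≤ bit (h i) + bit (k i)) →
  ∣ tabulate f ∣ + ∣ tabulate g ∣ ≤ ∣ tabulate h ∣ + ∣ tabulate k ∣
count-pair-≤ f g h k pointwise =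
  subst₂ _≤_ (sym (count-pair≡sum f g)) (sym (count-pair≡sum h k)) (sum-mono-≤ pointwise)

count-pair-< : ∀ {N} (f g h k : Fin N → Bool) →
  (∀ i → bit (f i) + bit (g i) ≤ bit (h i) + bit (k i)) →
  (j : Fin N) → bit (f j) + bit (g j) < bit (h j) + bit (k j) →
  ∣ tabulate f ∣ + ∣ tabulate g ∣ < ∣ tabulate h ∣ + ∣ tabulate k ∣
count-pair-< f g h k pointwise j strict =
  subst₂ _<_ (sym (count-pair≡sum f g)) (sym (count-pair≡sum h k))
    (sum-mono-< pointwise j strict)

module Uncrossing {n : ℕ} (ρ μ : Subset n → ℕ)
  (ρ-submodular : ∀ X Y → ρ (X ∩ Y) + ρ (X ∪ Y) ≤ ρ X + ρ Y)
  (μ-supermodular : ∀ X Y → μ X + μ Y ≤ μ (X ∩ Y) + μ (X ∪ Y))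
  (cut : ∀ Z → Nonempty Z → μ Z ≤ ρ Z)
  {X Y : Subset n} (tightX : ρ X ≡ μ X) (tightY : ρ Y ≡ μ Y)
  (meet : Nonempty (X ∩ Y)) where

  private
    join : Nonempty (X ∪ Y)
    join = proj₁ meet , p⊆p∪q Y (proj₁ (x∈p∩q⁻ X Y (proj₂ meet)))

    uncrossed : ρ (X ∩ Y) + ρ (X ∪ Y) ≤ μ (X ∩ Y) + μ (X ∪ Y)
    uncrossed = ≤-trans (ρ-submodular X Y)
                  (≤-trans (≤-reflexive (cong₂ _+_ tightX tightY)) (μ-supermodular X Y))

  tight-∩ : ρ (X ∩ Y) ≡ μ (X ∩ Y)
  tight-∩ = ≤-antisym
    (+-cancelʳ-≤ _ _ _ (≤-trans uncrossed (+-monoʳ-≤ (μ (X ∩ Y)) (cut (X ∪ Y) join))))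
    (cut (X ∩ Y) meet)

  not-strict : ¬ (μ X + μ Y < μ (X ∩ Y) + μ (X ∪ Y))
  not-strict strict = <⇒≱ strict
    (≤-trans (+-mono-≤ (cut (X ∩ Y) meet) (cut (X ∪ Y) join))
      (≤-trans (ρ-submodular X Y) (≤-reflexive (cong₂ _+_ tightX tightY))))

enters-submodular : ∀ r h₁ h₂ t₁ t₂ →
  bit (r ∧ ((h₁ ∧ h₂) ∧ not (t₁ ∧ t₂))) + bit (r ∧ ((h₁ ∨ h₂) ∧ not (t₁ ∨ t₂)))
    ≤ bit (r ∧ (h₁ ∧ not t₁)) + bit (r ∧ (h₂ ∧ not t₂))
enters-submodular false _ _ _ _ = z≤n
enters-submodular true h₁ h₂ t₁ t₂ = ≤ᵇ⇒≤ _ _ (by-cases h₁ h₂ t₁ t₂)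
  where
  by-cases : ∀ h₁ h₂ t₁ t₂ →
    T (bit ((h₁ ∧ h₂) ∧ not (t₁ ∧ t₂)) + bit ((h₁ ∨ h₂) ∧ not (t₁ ∨ t₂))
         ≤ᵇ bit (h₁ ∧ not t₁) + bit (h₂ ∧ not t₂))
  by-cases true  true  true  true  = tt
  by-cases true  true  true  false = tt
  by-cases true  true  false true  = tt
  by-cases true  true  false false = tt
  by-cases true  false true  true  = tt
  by-cases true  false true  false = tt
  by-cases true  false false true  = tt
  by-cases true  false false false = tt
  by-cases false true  true  true  = tt
  by-cases false true  true  false = tt
  by-cases false true  false true  = tt
  by-cases false true  false false = tt
  by-cases false false true  true  = tt
  by-cases false false true  false = tt
  by-cases false false false true  = tt
  by-cases false false false false = tt

indicator-supermodular : ∀ a b c d →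
  (T a → T c) → (T b → T c) → (T a → T b → T d) → bit a + bit b ≤ bit c + bit d
indicator-supermodular true  true  c d a⇒c b⇒c ab⇒d
  with c | a⇒c tt | d | ab⇒d tt tt
... | true | _ | true | _ = s≤s (s≤s z≤n)
indicator-supermodular true  false c d a⇒c b⇒c ab⇒d with c | a⇒c tt
... | true | _ = s≤s z≤n
indicator-supermodular false true  c d a⇒c b⇒c ab⇒d with c | b⇒c tt
... | true | _ = s≤s z≤n
indicator-supermodular false false c d a⇒c b⇒c ab⇒d = z≤n

module _ (D : Digraph) where
  open Digraph D

  enters : Subset m → Subset n → Fin m → Bool
  enters H Z a = lookup H a ∧ (lookup Z (head a) ∧ not (lookup Z (tail a)))

  ϱ-submodular : ∀ H X Y → ϱ D H (X ∩ Y) + ϱ D H (X ∪ Y) ≤ ϱ D H X + ϱ D H Y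
  ϱ-submodular H X Y =
    count-pair-≤ (enters H (X ∩ Y)) (enters H (X ∪ Y)) (enters H X) (enters H Y) pointwise
    where
    pointwise : ∀ a → bit (enters H (X ∩ Y) a) + bit (enters H (X ∪ Y) a)
                        ≤ bit (enters H X a) + bit (enters H Y a)
    pointwise a rewrite lookup-zipWith _∧_ (head a) X Y | lookup-zipWith _∧_ (tail a) X Y
                      | lookup-zipWith _∨_ (head a) X Y | lookup-zipWith _∨_ (tail a) X Y
      = enters-submodular (lookup H a) (lookup X (head a)) (lookup Y (head a))
                          (lookup X (tail a)) (lookup Y (tail a))

  module _ {k : ℕ} (V : Fin k → Subset n) where

    avoids : Subset n → Fin k → Bool
    avoids Z i = ⌊ ≡-dec BoolP._≟_ (V i ∩ Z) ⊥ ⌋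

    avoids-intro : ∀ Z i → (∀ v → v ∈ V i → v ∉ Z) → T (avoids Z i)
    avoids-intro Z i disjoint with ≡-dec BoolP._≟_ (V i ∩ Z) ⊥
    ... | yes _ = tt
    ... | no ≢⊥ = ≢⊥ (Empty-unique λ (v , v∈) →
                        let (v∈V , v∈Z) = x∈p∩q⁻ (V i) Z v∈ in disjoint v v∈V v∈Z)

    avoids-elim : ∀ Z i → T (avoids Z i) → ∀ v → v ∈ V i → v ∉ Z
    avoids-elim Z i avoid v v∈V v∈Z with ≡-dec BoolP._≟_ (V i ∩ Z) ⊥
    ... | yes ≡⊥ = ∉⊥ (subst (v ∈_) ≡⊥ (x∈p∩q⁺ (v∈V , v∈Z)))

    meets⇒¬avoids : ∀ Z i → Nonempty (Z ∩ V i) → avoids Z i ≡ false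
    meets⇒¬avoids Z i (v , v∈) with avoids Z i in eq
    ... | false = refl
    ... | true  = ⊥-elim (avoids-elim Z i (subst T (sym eq) tt) v
                            (proj₂ (x∈p∩q⁻ Z (V i) v∈)) (proj₁ (x∈p∩q⁻ Z (V i) v∈)))

    avoids-supermodular : ∀ X Y i →
      bit (avoids X i) + bit (avoids Y i) ≤ bit (avoids (X ∩ Y) i) + bit (avoids (X ∪ Y) i)
    avoids-supermodular X Y i = indicator-supermodular _ _ _ _
      (λ avX → avoids-intro (X ∩ Y) i λ v v∈V v∈ →
                 avoids-elim X i avX v v∈V (proj₁ (x∈p∩q⁻ X Y v∈)))
      (λ avY → avoids-intro (X ∩ Y) i λ v v∈V v∈ →
                 avoids-elim Y i avY v v∈V (proj₂ (x∈p∩q⁻ X Y v∈)))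
      (λ avX avY → avoids-intro (X ∪ Y) i λ v v∈V v∈ →
                 [ avoids-elim X i avX v v∈V , avoids-elim Y i avY v v∈V ] (x∈p∪q⁻ X Y v∈))

    avoids-strict : ∀ X Y i → Nonempty (X ∩ V i) → Nonempty (Y ∩ V i) →
      ¬ Nonempty ((X ∩ Y) ∩ V i) →
      bit (avoids X i) + bit (avoids Y i) < bit (avoids (X ∩ Y) i) + bit (avoids (X ∪ Y) i)
    avoids-strict X Y i meetX meetY ¬meetXY
      rewrite meets⇒¬avoids X i meetX | meets⇒¬avoids Y i meetY
      with avoids (X ∩ Y) i
         | avoids-intro (X ∩ Y) i (λ v v∈V v∈XY → ¬meetXY (v , x∈p∩q⁺ (v∈XY , v∈V)))
    ... | true | _ = s≤s z≤n

    module _ (A : Fin k → Subset m) where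

      missing-supermodular : ∀ X Y →
        missing D V A X + missing D V A Y ≤ missing D V A (X ∩ Y) + missing D V A (X ∪ Y)
      missing-supermodular X Y = count-pair-≤ (avoids X) (avoids Y)
        (avoids (X ∩ Y)) (avoids (X ∪ Y)) (avoids-supermodular X Y)

      missing-strict : ∀ X Y i → Nonempty (X ∩ V i) → Nonempty (Y ∩ V i) →
        ¬ Nonempty ((X ∩ Y) ∩ V i) →
        missing D V A X + missing D V A Y < missing D V A (X ∩ Y) + missing D V A (X ∪ Y)
      missing-strict X Y i meetX meetY ¬meetXY = count-pair-< (avoids X) (avoids Y)
        (avoids (X ∩ Y)) (avoids (X ∪ Y)) (avoids-supermodular X Y) i
        (avoids-strict X Y i meetX meetY ¬meetXY)

proposition1 : (D : Digraph) (k : ℕ)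
    (V : Fin k → Subset (Digraph.n D)) (A : Fin k → Subset (Digraph.m D)) →
    (∀ i → IsBranching D (V i) (A i)) →
    (∀ i j → ¬ (i ≡ j) → A i ∩ A j ≡ ⊥) →
    (∀ (X : Subset (Digraph.n D)) → Nonempty X →
    ϱ D (remaining D V A) X ≥ missing D V A X) →
    (X Y : Subset (Digraph.n D)) →
    Dangerous D V A X → Dangerous D V A Y → Nonempty (X ∩ Y) →
    Dangerous D V A (X ∩ Y)
proposition1 D k V A _ _ cut X Y
  ((_ , tightX) , (i , i≡0 , meetX)) ((_ , tightY) , (j , j≡0 , meetY)) meet =
  (meet , tight-∩) , (i , i≡0 , meetXY)
  where
  open Uncrossing (ϱ D (remaining D V A)) (missing D V A)
    (ϱ-submodular D (remaining D V A)) (missing-supermodular D V A) cut tightX tightY meet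
  -- Y meets the same root set V i, since i and j both denote index 0.
  meetY′ : Nonempty (Y ∩ V i)
  meetY′ = subst (λ l → Nonempty (Y ∩ V l)) (toℕ-injective (trans j≡0 (sym i≡0))) meetY
  meetXY : Nonempty ((X ∩ Y) ∩ V i)
  meetXY with nonempty? ((X ∩ Y) ∩ V i)
  ... | yes nonempty = nonempty
  ... | no  empty    = ⊥-elim (not-strict (missing-strict D V A X Y i meetX meetY′ empty))
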